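{- Let $A$ be a finite set of actions partitioned as $A=A^l\uplus A^r$, with $\mathcal{P}$, $\lesssim_{cc}$, $\mathcal{L}$, $\models$, $\leq$ and representation as in the context. Every formula $\phi\in\mathcal{L}$ is represented by some finite (possibly empty) set $M\subseteq\mathcal{P}$ of processes. Moreover, $\phi$ is represented by a single process $p\in\mathcal{P}$ if and only if $\phi$ is consistent and prime.
   Context: Process terms over $A$ are given by $p::=0\mid\omega\mid a.p\mid p+p$ with $a\in A$; the set of process terms is $\mathcal{P}$. Their transitions are the least relation satisfying: $\omega\xrightarrow{b}\omega$ for every $b\in A^l$; $a.p\xrightarrow{a}p$ for every $a\in A$; if $p\xrightarrow{a}p'$ then $p+q\xrightarrow{a}p'$ and $q+p\xrightarrow{a}p'$. A covariant-contravariant simulation is a relation $R\subseteq\mathcal{P}\times\mathcal{P}$ such that whenever $p\,R\,q$: for all $a\in A^r$ and all $p\xrightarrow{a}p'$ there is $q\xrightarrow{a}q'$ with $p'\,R\,q'$; and for all $b\in A^l$ and all $q\xrightarrow{b}q'$ there is $p\xrightarrow{b}p'$ with $p'\,R\,q'$. Write $p\lesssim_{cc}q$ iff some covariant-contravariant simulation contains $(p,q)$. The logic $\mathcal{L}$ has syntax $\varphi::=\bot\mid\top\mid\varphi\land\varphi\mid\varphi\lor\varphi\mid[b]\varphi\mid\langle a\rangle\varphi$ with $a\in A^r$, $b\in A^l$; $\bot,\top,\land,\lor$ have the usual meaning, $p\models[b]\varphi$ iff $p'\models\varphi$ for all $p\xrightarrow{b}p'$, and $p\models\langle a\rangle\varphi$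 iff $p'\models\varphi$ for some $p\xrightarrow{a}p'$. Write $\phi\leq\psi$ iff every $p\in\mathcal{P}$ with $p\models\phi$ satisfies $p\models\psi$. A formula $\phi$ is consistent iff $p\models\phi$ for some $p\in\mathcal{P}$; it is prime iff for all $\phi_1,\phi_2\in\mathcal{L}$, $\phi\leq\phi_1\lor\phi_2$ implies $\phi\leq\phi_1$ or $\phi\leq\phi_2$. A formula $\phi$ is represented by a process $p\in\mathcal{P}$ iff for all $q\in\mathcal{P}$: $q\models\phi\iff p\lesssim_{cc}q$; it is represented by a finite set $M\subseteq\mathcal{P}$ iff for all $q\in\mathcal{P}$: $q\models\phi\iff\exists p\in M.\ p\lesssim_{cc}q$. -}

module Defs where

open import Level using (Level; suc; _⊔_) renaming (zero to lzero)
open import Data.Nat using (ℕ)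
open import Data.Fin using (Fin)
open import Data.Product using (Σ; ∃; _×_; _,_)
open import Data.Sum using (_⊎_)
open import Data.List using (List)
open import Data.List.Membership.Propositional using (_∈_)
open import Relation.Binary.PropositionalEquality using (_≡_)

-- The finite action set A is Fin n; the partition A = A^l ⊎ A^r is given
-- by a function assigning each action its side.
data Side : Set where
  left right : Side

module CC (n : ℕ) (side : Fin n → Side) where

  Act : Set
  Act = Fin n

  data Proc : Set where
    𝟘   : Proc
    Ω   : Proc
    _∙_ : Act → Proc → Proc
    _⊕_ : Proc → Proc → Proc

  infixr 20 _∙_
  infixl 10 _⊕_

  data _─[_]→_ : Proc → Act → Proc → Set where
    ω-step : ∀ b → side b ≡ left → Ω ─[ b ]→ Ω
    pre    : ∀ a p → (a ∙ p) ─[ a ]→ p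
    sumˡ   : ∀ {p a p'} q → p ─[ a ]→ p' → (p ⊕ q) ─[ a ]→ p'
    sumʳ   : ∀ {p a p'} q → p ─[ a ]→ p' → (q ⊕ p) ─[ a ]→ p'

  IsCCSim : (Proc → Proc → Set) → Set
  IsCCSim R = ∀ {p q} → R p q →
      (∀ a → side a ≡ right → ∀ {p'} → p ─[ a ]→ p' →
          ∃ λ q' → (q ─[ a ]→ q') × R p' q')
    × (∀ b → side b ≡ left → ∀ {q'} → q ─[ b ]→ q' →
          ∃ λ p' → (p ─[ b ]→ p') × R p' q')

  _≲cc_ : Proc → Proc → Set₁
  p ≲cc q = Σ (Proc → Proc → Set) λ R → IsCCSim R × R p q

  data Form : Set where
    ⊥f ⊤f : Form
    _∧f_ _∨f_ : Form → Form → Form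
    [_,_]_ : (b : Act) → side b ≡ left → Form → Form
    ⟨_,_⟩_ : (a : Act) → side a ≡ right → Form → Form

  data _⊨_ : Proc → Form → Set where
    sat-⊤ : ∀ {p} → p ⊨ ⊤f
    sat-∧ : ∀ {p φ ψ} → p ⊨ φ → p ⊨ ψ → p ⊨ (φ ∧f ψ)
    sat-∨ˡ : ∀ {p φ ψ} → p ⊨ φ → p ⊨ (φ ∨f ψ)
    sat-∨ʳ : ∀ {p φ ψ} → p ⊨ ψ → p ⊨ (φ ∨f ψ)
    sat-box : ∀ {p b e φ} → (∀ {p'} → p ─[ b ]→ p' → p' ⊨ φ) → p ⊨ ([ b , e ] φ)
    sat-dia : ∀ {p a e φ p'} → p ─[ a ]→ p' → p' ⊨ φ → p ⊨ (⟨ a , e ⟩ φ)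

  _≤L_ : Form → Form → Set
  φ ≤L ψ = ∀ p → p ⊨ φ → p ⊨ ψ

  Consistent : Form → Set
  Consistent φ = ∃ λ p → p ⊨ φ

  Prime : Form → Set
  Prime φ = ∀ φ₁ φ₂ → φ ≤L (φ₁ ∨f φ₂) → (φ ≤L φ₁) ⊎ (φ ≤L φ₂)

  _⇔_ : ∀ {a b} → Set a → Set b → Set (a ⊔ b)
  X ⇔ Y = (X → Y) × (Y → X)

  RepresentedBy : Form → Proc → Set₁
  RepresentedBy φ p = ∀ q → (q ⊨ φ) ⇔ (p ≲cc q)

  -- finite sets of processes as lists
  RepresentedBySet : Form → List Proc → Set₁
  RepresentedBySet φ M = ∀ q → (q ⊨ φ) ⇔ (∃ λ p → (p ∈ M) × (p ≲cc q))

-- The proof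
-- decomposes every formula into finitely many *components* (p , θ) such
-- that p represents θ and φ is logically equivalent to the disjunction of
-- the θ's; the processes of the components then represent φ as a set.
-- Components are built by structural recursion on φ, using that the
-- preorder has
--   * a least element Ω                               (for ⊤),
--   * binary joins  join p q                          (for ∧),
--   * "box" processes  box b ps  whose upper sets are the processes all
--     of whose b-successors lie above some p ∈ ps     (for [b]),
--   * "diamond" processes  Ω ⊕ a∙p  whose upper sets are the processes
--     with an a-successor above p                     (for ⟨a⟩).
-- Each of these order-theoretic facts is proved with an up-to technique
-- for cc-simulations.  Finally, a represented formula is consistent and
-- prime because satisfaction is upward closed, and conversely a consistent
-- prime formula implies one of its components, which it is then
-- equivalent to.

module Submission where

open import Defs
open import Data.Nat using (ℕ)
open import Data.Fin using (Fin; _≟_)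
open import Data.Product using (Σ; ∃; _×_; _,_; proj₁; proj₂)
open import Data.Sum using (_⊎_; inj₁; inj₂)
open import Data.List using (List; []; _∷_; _++_; map; allFin; cartesianProductWith)
open import Data.List.Membership.Propositional using (_∈_; find; lose)
open import Data.List.Membership.Propositional.Properties using (∈-allFin)
open import Data.List.Relation.Unary.Any as Any using (Any; here; there)
open import Data.List.Relation.Unary.All as All using (All; []; _∷_)
import Data.List.Relation.Unary.Any.Properties as Anyₚ
import Data.List.Relation.Unary.All.Properties as Allₚ
open import Data.Empty using (⊥; ⊥-elim)
open import Relation.Nullary using (¬_; Dec; yes; no; ¬?; _×-dec_)
open import Relation.Binary.PropositionalEquality using (_≡_; refl; sym; trans; setoid)

module Theory (n : ℕ) (side : Fin n → Side) where
  open CC n side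

  sides-disjoint : ∀ {a} → side a ≡ left → side a ≡ right → ⊥
  sides-disjoint l r with trans (sym l) r
  ... | ()

  _≟ˢ_ : (s s' : Side) → Dec (s ≡ s')
  left  ≟ˢ left  = yes refl
  left  ≟ˢ right = no λ ()
  right ≟ˢ left  = no λ ()
  right ≟ˢ right = yes refl

  Ω-step : ∀ {a x} → Ω ─[ a ]→ x → side a ≡ left × x ≡ Ω
  Ω-step (ω-step _ l) = l , refl

  ≲-refl : ∀ p → p ≲cc p
  ≲-refl p = _≡_ , identity , refl
    where
    identity : IsCCSim _≡_
    identity refl = (λ _ _ t → _ , t , refl) , (λ _ _ t → _ , t , refl)

  ≲-trans : ∀ {p q r} → p ≲cc q → q ≲cc r → p ≲cc r
  ≲-trans {q = q} (R , simR , pRq) (S , simS , qSr) = R⨾S , composite , (q , pRq , qSr)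
    where
    R⨾S : Proc → Proc → Set
    R⨾S x z = ∃ λ y → R x y × S y z
    composite : IsCCSim R⨾S
    composite (y , xRy , ySz) =
        (λ a e t → let (y' , ty , r) = proj₁ (simR xRy) a e t
                       (z' , tz , s) = proj₁ (simS ySz) a e ty
                   in z' , tz , (y' , r , s))
      , (λ b e t → let (y' , ty , s) = proj₂ (simS ySz) b e t
                       (x' , tx , r) = proj₂ (simR xRy) b e ty
                   in x' , tx , (y' , r , s))

  -- Ω is the least process: it has no right moves and answers every left move.
  Ω-least : ∀ q → Ω ≲cc q
  Ω-least q = (λ x _ → x ≡ Ω) , sim , refl
    where
    sim : IsCCSim (λ x _ → x ≡ Ω)
    sim refl = (λ a r t → ⊥-elim (sides-disjoint (proj₁ (Ω-step t)) r))
             , (λ b l _ → Ω , ω-step b l , refl)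

  ≲-right : ∀ {p q a p'} → p ≲cc q → side a ≡ right → p ─[ a ]→ p' →
            ∃ λ q' → (q ─[ a ]→ q') × p' ≲cc q'
  ≲-right (S , sim , s) r t = let (q' , tq , s') = proj₁ (sim s) _ r t in q' , tq , (S , sim , s')

  ≲-left : ∀ {p q b q'} → p ≲cc q → side b ≡ left → q ─[ b ]→ q' →
           ∃ λ p' → (p ─[ b ]→ p') × p' ≲cc q'
  ≲-left (S , sim , s) l t = let (p' , tp , s') = proj₂ (sim s) _ l t in p' , tp , (S , sim , s')

  sat-mono : ∀ {p q} → p ≲cc q → ∀ φ → p ⊨ φ → q ⊨ φ
  sat-mono p≲q ⊤f sat-⊤ = sat-⊤
  sat-mono p≲q (φ ∧f ψ) (sat-∧ s s') = sat-∧ (sat-mono p≲q φ s) (sat-mono p≲q ψ s')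
  sat-mono p≲q (φ ∨f ψ) (sat-∨ˡ s) = sat-∨ˡ (sat-mono p≲q φ s)
  sat-mono p≲q (φ ∨f ψ) (sat-∨ʳ s) = sat-∨ʳ (sat-mono p≲q ψ s)
  sat-mono p≲q ([ b , l ] φ) (sat-box h) =
    sat-box λ tq → let (p' , tp , p'≲q') = ≲-left p≲q l tq in sat-mono p'≲q' φ (h tp)
  sat-mono p≲q (⟨ a , r ⟩ φ) (sat-dia tp s) =
    let (q' , tq , p'≲q') = ≲-right p≲q r tp in sat-dia tq (sat-mono p'≲q' φ s)

  SimUpTo : (Proc → Proc → Set) → Set₁
  SimUpTo R = ∀ {p q} → R p q →
      (∀ a → side a ≡ right → ∀ {p'} → p ─[ a ]→ p' →
          ∃ λ q' → (q ─[ a ]→ q') × (R p' q' ⊎ p' ≲cc q'))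
    × (∀ b → side b ≡ left → ∀ {q'} → q ─[ b ]→ q' →
          ∃ λ p' → (p ─[ b ]→ p') × (R p' q' ⊎ p' ≲cc q'))

  -- Since ≲cc lives in Set₁ it cannot be
  -- joined to R directly; instead R is closed up by one witnessing simulation
  -- for each situation (a pair of R and a challenge to it), and this union
  -- is a cc-simulation.
  module UpTo (R : Proc → Proc → Set) (R-up-to : SimUpTo R) where

    Challenge : Proc → Proc → Set
    Challenge p q = (Σ Act λ a → side a ≡ right × ∃ λ p' → p ─[ a ]→ p')
                  ⊎ (Σ Act λ b → side b ≡ left × ∃ λ q' → q ─[ b ]→ q')

    Situation : Set
    Situation = Σ Proc λ p → Σ Proc λ q → R p q × Challenge p q

    asSimulation : ∀ {x y} → R x y ⊎ x ≲cc y →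
                   Σ (Proc → Proc → Set) λ S → IsCCSim S × (R x y ⊎ S x y)
    asSimulation (inj₁ r) = (λ _ _ → ⊥) , (λ ()) , inj₁ r
    asSimulation (inj₂ (S , sim , s)) = S , sim , inj₂ s

    witness : Situation → Σ (Proc → Proc → Set) IsCCSim
    witness (_ , _ , r , inj₁ (a , e , _ , t)) =
      let (S , sim , _) = asSimulation (proj₂ (proj₂ (proj₁ (R-up-to r) a e t))) in S , sim
    witness (_ , _ , r , inj₂ (b , e , _ , t)) =
      let (S , sim , _) = asSimulation (proj₂ (proj₂ (proj₂ (R-up-to r) b e t))) in S , sim

    Closure : Proc → Proc → Set
    Closure x y = R x y ⊎ Σ Situation λ i → proj₁ (witness i) x y

    enter : (i : Situation) → ∀ {x y} → R x y ⊎ proj₁ (witness i) x y → Closure x y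
    enter i (inj₁ r) = inj₁ r
    enter i (inj₂ s) = inj₂ (i , s)

    closure-sim : IsCCSim Closure
    closure-sim {p} {q} (inj₁ r) =
        (λ a e {p'} t → let (q' , tq , z) = proj₁ (R-up-to r) a e t
                        in q' , tq , enter (p , q , r , inj₁ (a , e , p' , t)) (proj₂ (proj₂ (asSimulation z))))
      , (λ b e {q'} t → let (p' , tp , z) = proj₂ (R-up-to r) b e t
                        in p' , tp , enter (p , q , r , inj₂ (b , e , q' , t)) (proj₂ (proj₂ (asSimulation z))))
    closure-sim (inj₂ (i , s)) =
        (λ a e t → let (q' , tq , s') = proj₁ (proj₂ (witness i) s) a e t in q' , tq , inj₂ (i , s'))
      , (λ b e t → let (p' , tp , s') = proj₂ (proj₂ (witness i) s) b e t in p' , tp , inj₂ (i , s'))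

  ≲-up-to : (R : Proc → Proc → Set) → SimUpTo R → ∀ {p q} → R p q → p ≲cc q
  ≲-up-to R R-up-to r = Closure , closure-sim , inj₁ r
    where open UpTo R R-up-to

  ≲-intro : ∀ {p q} →
    (∀ a → side a ≡ right → ∀ {p'} → p ─[ a ]→ p' → ∃ λ q' → (q ─[ a ]→ q') × p' ≲cc q') →
    (∀ b → side b ≡ left → ∀ {q'} → q ─[ b ]→ q' → ∃ λ p' → (p ─[ b ]→ p') × p' ≲cc q') →
    p ≲cc q
  ≲-intro {p} {q} right-moves left-moves = ≲-up-to (λ x y → x ≡ p × y ≡ q) answer (refl , refl)
    where
    answer : SimUpTo (λ x y → x ≡ p × y ≡ q)
    answer (refl , refl) =
        (λ a r t → let (q' , tq , s) = right-moves a r t in q' , tq , inj₂ s)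
      , (λ b l t → let (p' , tp , s) = left-moves b l t in p' , tp , inj₂ s)

  guard : ∀ {P : Set} → Dec P → Proc → Proc
  guard (yes _) p = p
  guard (no _)  p = 𝟘

  guard-intro : ∀ {P : Set} (d : Dec P) {p a x} → P → p ─[ a ]→ x → guard d p ─[ a ]→ x
  guard-intro (yes _) _ t = t
  guard-intro (no ¬h) h _ = ⊥-elim (¬h h)

  guard-step : ∀ {P : Set} (d : Dec P) {p a x} → guard d p ─[ a ]→ x → P × p ─[ a ]→ x
  guard-step (yes h) t = h , t

  ⨁ : List Proc → Proc
  ⨁ []       = 𝟘
  ⨁ (p ∷ ps) = p ⊕ ⨁ ps

  ⨁-intro : ∀ {ps a x} → Any (_─[ a ]→ x) ps → ⨁ ps ─[ a ]→ x
  ⨁-intro {p ∷ ps} (here t)  = sumˡ (⨁ ps) t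
  ⨁-intro {p ∷ ps} (there t) = sumʳ p (⨁-intro t)

  ⨁-step : ∀ {ps a x} → ⨁ ps ─[ a ]→ x → Any (_─[ a ]→ x) ps
  ⨁-step {p ∷ ps} (sumˡ _ t) = here t
  ⨁-step {p ∷ ps} (sumʳ _ t) = there (⨁-step t)

  restrict : Side → Proc → Proc
  restrict s 𝟘       = 𝟘
  restrict s Ω       = guard (left ≟ˢ s) Ω
  restrict s (a ∙ p) = guard (side a ≟ˢ s) (a ∙ p)
  restrict s (p ⊕ q) = restrict s p ⊕ restrict s q

  restrict-intro : ∀ {s p a x} → side a ≡ s → p ─[ a ]→ x → restrict s p ─[ a ]→ x
  restrict-intro refl (ω-step b l) = guard-intro (left ≟ˢ side b) (sym l) (ω-step b l)
  restrict-intro refl (pre a p)    = guard-intro (side a ≟ˢ side a) refl (pre a p)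
  restrict-intro e (sumˡ q t)      = sumˡ _ (restrict-intro e t)
  restrict-intro e (sumʳ q t)      = sumʳ _ (restrict-intro e t)

  restrict-step : ∀ {s p a x} → restrict s p ─[ a ]→ x → side a ≡ s × p ─[ a ]→ x
  restrict-step {s} {Ω} t with guard-step (left ≟ˢ s) t
  ... | left≡s , ω-step b l = trans l left≡s , ω-step b l
  restrict-step {s} {c ∙ p} t with guard-step (side c ≟ˢ s) t
  ... | c≡s , pre _ _ = c≡s , pre c p
  restrict-step {p = p ⊕ q} (sumˡ _ t) = let (e , t') = restrict-step t in e , sumˡ q t'
  restrict-step {p = p ⊕ q} (sumʳ _ t) = let (e , t') = restrict-step t in e , sumʳ p t'

  -- join p q has the right moves of p and of q, and for every left action b
  -- one b-move to (the join of) each pair of b-successors of p and q.  Ω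
  -- acts as a unit, which keeps the recursion structural.
  mutual
    join : Proc → Proc → Proc
    join p q = (restrict right p ⊕ restrict right q) ⊕ sync p q

    sync : Proc → Proc → Proc
    sync 𝟘         q = 𝟘
    sync Ω         q = restrict left q
    sync (a ∙ p)   q = guard (side a ≟ˢ left) (syncWith a p q)
    sync (p₁ ⊕ p₂) q = sync p₁ q ⊕ sync p₂ q

    syncWith : Act → Proc → Proc → Proc
    syncWith a p 𝟘         = 𝟘
    syncWith a p Ω         = a ∙ p
    syncWith a p (c ∙ q)   = guard (c ≟ a) (a ∙ join p q)
    syncWith a p (q₁ ⊕ q₂) = syncWith a p q₁ ⊕ syncWith a p q₂

  JoinOf : Proc → Proc → Proc → Set
  JoinOf p q x = x ≡ join p q ⊎ (p ≡ Ω × x ≡ q) ⊎ (q ≡ Ω × x ≡ p)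

  syncWith-intro : ∀ {a p q q'} → q ─[ a ]→ q' → ∃ λ x → syncWith a p q ─[ a ]→ x × JoinOf p q' x
  syncWith-intro {p = p} (ω-step a _) = p , pre a p , inj₂ (inj₂ (refl , refl))
  syncWith-intro {p = p} (pre a q) = join p q , guard-intro (a ≟ a) refl (pre a _) , inj₁ refl
  syncWith-intro (sumˡ q t) = let (x , tx , j) = syncWith-intro t in x , sumˡ _ tx , j
  syncWith-intro (sumʳ q t) = let (x , tx , j) = syncWith-intro t in x , sumʳ _ tx , j

  syncWith-step : ∀ {a p q c x} → side a ≡ left → syncWith a p q ─[ c ]→ x →
                  c ≡ a × ∃ λ q' → q ─[ a ]→ q' × JoinOf p q' x
  syncWith-step {q = Ω} l (pre _ _) = refl , Ω , ω-step _ l , inj₂ (inj₂ (refl , refl))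
  syncWith-step {a} {q = c ∙ q} _ t with guard-step (c ≟ a) t
  ... | refl , pre _ _ = refl , q , pre c q , inj₁ refl
  syncWith-step {q = q₁ ⊕ q₂} l (sumˡ _ t) =
    let (c≡a , q' , tq , j) = syncWith-step l t in c≡a , q' , sumˡ q₂ tq , j
  syncWith-step {q = q₁ ⊕ q₂} l (sumʳ _ t) =
    let (c≡a , q' , tq , j) = syncWith-step l t in c≡a , q' , sumʳ q₁ tq , j

  sync-intro : ∀ {b p q p' q'} → side b ≡ left → p ─[ b ]→ p' → q ─[ b ]→ q' →
               ∃ λ x → sync p q ─[ b ]→ x × JoinOf p' q' x
  sync-intro {q' = q'} l (ω-step _ _) tq = q' , restrict-intro l tq , inj₂ (inj₁ (refl , refl))
  sync-intro l (pre b _) tq =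
    let (x , tx , j) = syncWith-intro tq in x , guard-intro (side b ≟ˢ left) l tx , j
  sync-intro l (sumˡ r tp) tq = let (x , tx , j) = sync-intro l tp tq in x , sumˡ _ tx , j
  sync-intro l (sumʳ r tp) tq = let (x , tx , j) = sync-intro l tp tq in x , sumʳ _ tx , j

  sync-step : ∀ {p q b x} → sync p q ─[ b ]→ x →
    side b ≡ left × ∃ λ p' → ∃ λ q' → p ─[ b ]→ p' × q ─[ b ]→ q' × JoinOf p' q' x
  sync-step {Ω} t =
    let (l , tq) = restrict-step t in l , Ω , _ , ω-step _ l , tq , inj₂ (inj₁ (refl , refl))
  sync-step {c ∙ p} t with guard-step (side c ≟ˢ left) t
  ... | l , t' with syncWith-step l t'
  ... | refl , q' , tq , j = l , p , q' , pre c p , tq , j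
  sync-step {p₁ ⊕ p₂} (sumˡ _ t) =
    let (l , p' , q' , tp , tq , j) = sync-step t in l , p' , q' , sumˡ p₂ tp , tq , j
  sync-step {p₁ ⊕ p₂} (sumʳ _ t) =
    let (l , p' , q' , tp , tq , j) = sync-step t in l , p' , q' , sumʳ p₁ tp , tq , j

  join-right-step : ∀ {p q a x} → side a ≡ right → join p q ─[ a ]→ x → p ─[ a ]→ x ⊎ q ─[ a ]→ x
  join-right-step r (sumˡ _ (sumˡ _ t)) = inj₁ (proj₂ (restrict-step t))
  join-right-step r (sumˡ _ (sumʳ _ t)) = inj₂ (proj₂ (restrict-step t))
  join-right-step {p} {q} r (sumʳ _ t) = ⊥-elim (sides-disjoint (proj₁ (sync-step {p} {q} t)) r)

  join-left-step : ∀ {p q b x} → side b ≡ left → join p q ─[ b ]→ x →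
    ∃ λ p' → ∃ λ q' → p ─[ b ]→ p' × q ─[ b ]→ q' × JoinOf p' q' x
  join-left-step {p} l (sumˡ _ (sumˡ _ t)) = ⊥-elim (sides-disjoint l (proj₁ (restrict-step {p = p} t)))
  join-left-step {q = q} l (sumˡ _ (sumʳ _ t)) = ⊥-elim (sides-disjoint l (proj₁ (restrict-step {p = q} t)))
  join-left-step {p} {q} l (sumʳ _ t) = proj₂ (sync-step {p} {q} t)

  join-left-intro : ∀ {p q b p' q'} → side b ≡ left → p ─[ b ]→ p' → q ─[ b ]→ q' →
                    ∃ λ x → join p q ─[ b ]→ x × JoinOf p' q' x
  join-left-intro l tp tq = let (x , tx , j) = sync-intro l tp tq in x , sumʳ _ tx , j

  join-upper : ∀ p q → p ≲cc join p q × q ≲cc join p q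
  join-upper p q = ≲-up-to Below answer (p , q , refl , inj₁ refl)
                 , ≲-up-to Below answer (p , q , refl , inj₂ refl)
    where
    Below : Proc → Proc → Set
    Below x y = ∃ λ p → ∃ λ q → y ≡ join p q × (x ≡ p ⊎ x ≡ q)

    below-parts : ∀ {p' q' x} → JoinOf p' q' x →
                  (Below p' x ⊎ p' ≲cc x) × (Below q' x ⊎ q' ≲cc x)
    below-parts {p'} {q'} (inj₁ refl) = inj₁ (p' , q' , refl , inj₁ refl) , inj₁ (p' , q' , refl , inj₂ refl)
    below-parts {x = x} (inj₂ (inj₁ (refl , refl))) = inj₂ (Ω-least x) , inj₂ (≲-refl x)
    below-parts {x = x} (inj₂ (inj₂ (refl , refl))) = inj₂ (≲-refl x) , inj₂ (Ω-least x)

    answer : SimUpTo Below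
    answer (p , q , refl , part) = right-moves part , left-moves part
      where
      right-moves : ∀ {x} → x ≡ p ⊎ x ≡ q → ∀ a → side a ≡ right → ∀ {x'} → x ─[ a ]→ x' →
                    ∃ λ y' → (join p q ─[ a ]→ y') × (Below x' y' ⊎ x' ≲cc y')
      right-moves (inj₁ refl) a r {x'} t = x' , sumˡ _ (sumˡ _ (restrict-intro r t)) , inj₂ (≲-refl x')
      right-moves (inj₂ refl) a r {x'} t = x' , sumˡ _ (sumʳ _ (restrict-intro r t)) , inj₂ (≲-refl x')
      left-moves : ∀ {x} → x ≡ p ⊎ x ≡ q → ∀ b → side b ≡ left → ∀ {y'} → join p q ─[ b ]→ y' →
                   ∃ λ x' → (x ─[ b ]→ x') × (Below x' y' ⊎ x' ≲cc y')
      left-moves (inj₁ refl) b l t =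
        let (p' , q' , tp , tq , j) = join-left-step {p} {q} l t in p' , tp , proj₁ (below-parts j)
      left-moves (inj₂ refl) b l t =
        let (p' , q' , tp , tq , j) = join-left-step {p} {q} l t in q' , tq , proj₂ (below-parts j)

  join-least : ∀ {p q u} → p ≲cc u → q ≲cc u → join p q ≲cc u
  join-least {p} {q} (S₁ , sim₁ , s₁) (S₂ , sim₂ , s₂) = ≲-up-to Above answer (p , q , refl , s₁ , s₂)
    where
    Above : Proc → Proc → Set
    Above x u = ∃ λ p → ∃ λ q → x ≡ join p q × S₁ p u × S₂ q u

    above-join : ∀ {p' q' x u'} → S₁ p' u' → S₂ q' u' → JoinOf p' q' x → Above x u' ⊎ x ≲cc u'
    above-join {p'} {q'} s₁ s₂ (inj₁ refl) = inj₁ (p' , q' , refl , s₁ , s₂)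
    above-join s₁ s₂ (inj₂ (inj₁ (refl , refl))) = inj₂ (S₂ , sim₂ , s₂)
    above-join s₁ s₂ (inj₂ (inj₂ (refl , refl))) = inj₂ (S₁ , sim₁ , s₁)

    answer : SimUpTo Above
    answer {_} {u} (p , q , refl , s₁ , s₂) = right-moves , left-moves
      where
      right-moves : ∀ a → side a ≡ right → ∀ {x} → join p q ─[ a ]→ x →
                    ∃ λ u' → (u ─[ a ]→ u') × (Above x u' ⊎ x ≲cc u')
      right-moves a r t with join-right-step {p} {q} r t
      ... | inj₁ tp = let (u' , tu , s) = proj₁ (sim₁ s₁) a r tp in u' , tu , inj₂ (S₁ , sim₁ , s)
      ... | inj₂ tq = let (u' , tu , s) = proj₁ (sim₂ s₂) a r tq in u' , tu , inj₂ (S₂ , sim₂ , s)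
      left-moves : ∀ b → side b ≡ left → ∀ {u'} → u ─[ b ]→ u' →
                   ∃ λ x → (join p q ─[ b ]→ x) × (Above x u' ⊎ x ≲cc u')
      left-moves b l t =
        let (p' , tp , s₁') = proj₂ (sim₁ s₁) b l t
            (q' , tq , s₂') = proj₂ (sim₂ s₂) b l t
            (x , tx , j) = join-left-intro l tp tq
        in x , tx , above-join s₁' s₂' j

  join-≲ : ∀ {p q u} → (join p q ≲cc u) ⇔ (p ≲cc u × q ≲cc u)
  join-≲ {p} {q} = (λ j≲u → ≲-trans (proj₁ (join-upper p q)) j≲u , ≲-trans (proj₂ (join-upper p q)) j≲u)
                 , (λ (p≲u , q≲u) → join-least p≲u q≲u)

  escape : Act → Act → Proc
  escape b c = guard (side c ≟ˢ left ×-dec ¬? (c ≟ b)) (c ∙ Ω)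

  box : Act → List Proc → Proc
  box b ps = ⨁ (map (escape b) (allFin n)) ⊕ ⨁ (map (b ∙_) ps)

  box-escape : ∀ {b ps c} → side c ≡ left → ¬ c ≡ b → box b ps ─[ c ]→ Ω
  box-escape {b} {c = c} l c≢b =
    sumˡ _ (⨁-intro (Anyₚ.map⁺ (lose (∈-allFin c) (guard-intro (side c ≟ˢ left ×-dec ¬? (c ≟ b)) (l , c≢b) (pre c Ω)))))

  box-prefix : ∀ {b ps p} → p ∈ ps → box b ps ─[ b ]→ p
  box-prefix {b} {p = p} p∈ps = sumʳ _ (⨁-intro (Anyₚ.map⁺ (lose {P = λ y → (b ∙ y) ─[ b ]→ p} p∈ps (pre b p))))

  box-step : ∀ {b ps a x} → box b ps ─[ a ]→ x → (side a ≡ left × ¬ a ≡ b × x ≡ Ω) ⊎ (a ≡ b × x ∈ ps)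
  box-step {b} (sumˡ _ t) with find (Anyₚ.map⁻ (⨁-step t))
  ... | c , _ , tc with guard-step (side c ≟ˢ left ×-dec ¬? (c ≟ b)) tc
  ... | (l , c≢b) , pre _ _ = inj₁ (l , c≢b , refl)
  box-step (sumʳ _ t) with find (Anyₚ.map⁻ (⨁-step t))
  ... | p , p∈ps , pre _ _ = inj₂ (refl , p∈ps)

  box-≲ : ∀ {b ps q} → side b ≡ left → (box b ps ≲cc q) ⇔ (∀ {q'} → q ─[ b ]→ q' → Any (_≲cc q') ps)
  box-≲ {b} {ps} {q} l = above , λ successors → ≲-intro right-moves (left-moves successors)
    where
    above : box b ps ≲cc q → ∀ {q'} → q ─[ b ]→ q' → Any (_≲cc q') ps
    above box≲q tq with ≲-left box≲q l tq
    ... | x , tx , x≲q' with box-step tx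
    ... | inj₁ (_ , b≢b , _) = ⊥-elim (b≢b refl)
    ... | inj₂ (_ , x∈ps) = lose x∈ps x≲q'
    right-moves : ∀ a → side a ≡ right → ∀ {x} → box b ps ─[ a ]→ x → ∃ λ q' → (q ─[ a ]→ q') × x ≲cc q'
    right-moves a r t with box-step t
    ... | inj₁ (l' , _) = ⊥-elim (sides-disjoint l' r)
    ... | inj₂ (refl , _) = ⊥-elim (sides-disjoint l r)
    left-moves : (∀ {q'} → q ─[ b ]→ q' → Any (_≲cc q') ps) →
                 ∀ c → side c ≡ left → ∀ {q'} → q ─[ c ]→ q' → ∃ λ x → (box b ps ─[ c ]→ x) × x ≲cc q'
    left-moves successors c l' {q'} t with c ≟ b
    ... | yes refl = let (p , p∈ps , p≲q') = find (successors t) in p , box-prefix p∈ps , p≲q'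
    ... | no c≢b = Ω , box-escape l' c≢b , Ω-least q'

  dia-≲ : ∀ {a p q} → side a ≡ right → ((Ω ⊕ a ∙ p) ≲cc q) ⇔ (∃ λ q' → q ─[ a ]→ q' × p ≲cc q')
  dia-≲ {a} {p} {q} r = (λ le → ≲-right le r (sumʳ Ω (pre a p))) , λ succ → ≲-intro (right-moves succ) left-moves
    where
    right-moves : (∃ λ q' → q ─[ a ]→ q' × p ≲cc q') →
                  ∀ c → side c ≡ right → ∀ {x} → (Ω ⊕ a ∙ p) ─[ c ]→ x → ∃ λ q' → (q ─[ c ]→ q') × x ≲cc q'
    right-moves _ c r' (sumˡ _ t) = ⊥-elim (sides-disjoint (proj₁ (Ω-step t)) r')
    right-moves succ c r' (sumʳ _ (pre _ _)) = succ
    left-moves : ∀ c → side c ≡ left → ∀ {q'} → q ─[ c ]→ q' → ∃ λ x → ((Ω ⊕ a ∙ p) ─[ c ]→ x) × x ≲cc q'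
    left-moves c l {q'} _ = Ω , sumˡ _ (ω-step c l) , Ω-least q'

  Ω-represents-⊤ : RepresentedBy ⊤f Ω
  Ω-represents-⊤ q = (λ _ → Ω-least q) , (λ _ → sat-⊤)

  join-represents-∧ : ∀ {θ θ' p p'} → RepresentedBy θ p → RepresentedBy θ' p' →
                      RepresentedBy (θ ∧f θ') (join p p')
  join-represents-∧ rep rep' q =
      (λ { (sat-∧ s s') → proj₂ join-≲ (proj₁ (rep q) s , proj₁ (rep' q) s') })
    , λ j≲q → let (p≲q , p'≲q) = proj₁ join-≲ j≲q in sat-∧ (proj₂ (rep q) p≲q) (proj₂ (rep' q) p'≲q)

  dia-represents : ∀ {a θ p} (r : side a ≡ right) → RepresentedBy θ p →
                   RepresentedBy (⟨ a , r ⟩ θ) (Ω ⊕ a ∙ p)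
  dia-represents r rep q =
      (λ { (sat-dia t s) → proj₂ (dia-≲ r) (_ , t , proj₁ (rep _) s) })
    , λ le → let (q' , t , p≲q') = proj₁ (dia-≲ r) le in sat-dia t (proj₂ (rep q') p≲q')

  ⋁ : List Form → Form
  ⋁ []       = ⊥f
  ⋁ (θ ∷ θs) = θ ∨f ⋁ θs

  ⋁-sat : ∀ {q} θs → (q ⊨ ⋁ θs) ⇔ Any (q ⊨_) θs
  ⋁-sat {q} θs = to θs , from
    where
    to : ∀ θs → q ⊨ ⋁ θs → Any (q ⊨_) θs
    to (θ ∷ θs) (sat-∨ˡ s) = here s
    to (θ ∷ θs) (sat-∨ʳ s) = there (to θs s)
    from : ∀ {θs} → Any (q ⊨_) θs → q ⊨ ⋁ θs
    from (here s)  = sat-∨ˡ s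
    from (there s) = sat-∨ʳ (from s)

  Faithful : Proc × Form → Set₁
  Faithful x = RepresentedBy (proj₂ x) (proj₁ x)

  faithful-any : ∀ {cs} → All Faithful cs → ∀ q →
                 Any (λ x → q ⊨ proj₂ x) cs ⇔ Any (λ x → proj₁ x ≲cc q) cs
  faithful-any fs q = to fs , from fs
    where
    to : ∀ {cs} → All Faithful cs → Any (λ x → q ⊨ proj₂ x) cs → Any (λ x → proj₁ x ≲cc q) cs
    to (f ∷ _)  (here s)  = here (proj₁ (f q) s)
    to (_ ∷ fs) (there s) = there (to fs s)
    from : ∀ {cs} → All Faithful cs → Any (λ x → proj₁ x ≲cc q) cs → Any (λ x → q ⊨ proj₂ x) cs
    from (f ∷ _)  (here le)  = here (proj₂ (f q) le)
    from (_ ∷ fs) (there le) = there (from fs le)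

  box-represents : ∀ {b cs} (l : side b ≡ left) → All Faithful cs →
                   RepresentedBy ([ b , l ] ⋁ (map proj₂ cs)) (box b (map proj₁ cs))
  box-represents {b} {cs} l fs q =
      (λ { (sat-box h) → proj₂ (box-≲ l) λ t →
             Anyₚ.map⁺ (proj₁ (faithful-any fs _) (Anyₚ.map⁻ (proj₁ (⋁-sat _) (h t)))) })
    , λ le → sat-box λ t →
             proj₂ (⋁-sat _) (Anyₚ.map⁺ (proj₂ (faithful-any fs _) (Anyₚ.map⁻ (proj₁ (box-≲ l) le t))))

  meet : Proc × Form → Proc × Form → Proc × Form
  meet x y = join (proj₁ x) (proj₁ y) , proj₂ x ∧f proj₂ y

  diamond : (a : Act) → side a ≡ right → Proc × Form → Proc × Form
  diamond a r x = (Ω ⊕ a ∙ proj₁ x) , ⟨ a , r ⟩ proj₂ x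

  components : Form → List (Proc × Form)
  components ⊥f            = []
  components ⊤f            = (Ω , ⊤f) ∷ []
  components (φ ∧f ψ)      = cartesianProductWith meet (components φ) (components ψ)
  components (φ ∨f ψ)      = components φ ++ components ψ
  components ([ b , l ] φ) =
    (box b (map proj₁ (components φ)) , [ b , l ] ⋁ (map proj₂ (components φ))) ∷ []
  components (⟨ a , r ⟩ φ) = map (diamond a r) (components φ)

  components-faithful : ∀ φ → All Faithful (components φ)
  components-faithful ⊥f = []
  components-faithful ⊤f = Ω-represents-⊤ ∷ []
  components-faithful (φ ∧f ψ) =
    Allₚ.cartesianProductWith⁺ (setoid _) (setoid _) meet (components φ) (components ψ)
      λ x∈ y∈ → join-represents-∧ (All.lookup (components-faithful φ) x∈) (All.lookup (components-faithful ψ) y∈)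
  components-faithful (φ ∨f ψ) = Allₚ.++⁺ (components-faithful φ) (components-faithful ψ)
  components-faithful ([ b , l ] φ) = box-represents l (components-faithful φ) ∷ []
  components-faithful (⟨ a , r ⟩ φ) = Allₚ.map⁺ (All.map (dia-represents r) (components-faithful φ))

  components-cover : ∀ φ q → (q ⊨ φ) ⇔ Any (λ x → q ⊨ proj₂ x) (components φ)
  components-cover ⊥f q = (λ ()) , (λ ())
  components-cover ⊤f q = (λ _ → here sat-⊤) , (λ _ → sat-⊤)
  components-cover (φ ∧f ψ) q =
      (λ { (sat-∧ s t) → Anyₚ.cartesianProductWith⁺ meet sat-∧
                           (proj₁ (components-cover φ q) s) (proj₁ (components-cover ψ q) t) })
    , λ h → let (sφ , sψ) = Anyₚ.cartesianProductWith⁻ meet (λ { (sat-∧ s t) → s , t })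
                                (components φ) (components ψ) h
            in sat-∧ (proj₂ (components-cover φ q) sφ) (proj₂ (components-cover ψ q) sψ)
  components-cover (φ ∨f ψ) q = to , from
    where
    to : q ⊨ (φ ∨f ψ) → Any (λ x → q ⊨ proj₂ x) (components (φ ∨f ψ))
    to (sat-∨ˡ s) = Anyₚ.++⁺ˡ (proj₁ (components-cover φ q) s)
    to (sat-∨ʳ s) = Anyₚ.++⁺ʳ (components φ) (proj₁ (components-cover ψ q) s)
    from : Any (λ x → q ⊨ proj₂ x) (components (φ ∨f ψ)) → q ⊨ (φ ∨f ψ)
    from h with Anyₚ.++⁻ (components φ) h
    ... | inj₁ hφ = sat-∨ˡ (proj₂ (components-cover φ q) hφ)
    ... | inj₂ hψ = sat-∨ʳ (proj₂ (components-cover ψ q) hψ)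
  components-cover ([ b , l ] φ) q =
      (λ { (sat-box h) → here (sat-box λ t → proj₂ (⋁-sat _) (Anyₚ.map⁺ (proj₁ (components-cover φ _) (h t)))) })
    , λ { (here (sat-box h)) → sat-box λ t → proj₂ (components-cover φ _) (Anyₚ.map⁻ (proj₁ (⋁-sat _) (h t))) }
  components-cover (⟨ a , r ⟩ φ) q = to , from
    where
    to : q ⊨ (⟨ a , r ⟩ φ) → Any (λ x → q ⊨ proj₂ x) (components (⟨ a , r ⟩ φ))
    to (sat-dia t s) = Anyₚ.map⁺ (Any.map (sat-dia t) (proj₁ (components-cover φ _) s))
    from : Any (λ x → q ⊨ proj₂ x) (components (⟨ a , r ⟩ φ)) → q ⊨ (⟨ a , r ⟩ φ)
    from h with find (Anyₚ.map⁻ h)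
    ... | x , x∈ , sat-dia t s = sat-dia t (proj₂ (components-cover φ _) (lose x∈ s))

  components-represent : ∀ φ → RepresentedBySet φ (map proj₁ (components φ))
  components-represent φ q =
      (λ s → find (Anyₚ.map⁺ (proj₁ (faithful-any F q) (proj₁ (components-cover φ q) s))))
    , λ (p , p∈ , p≲q) → proj₂ (components-cover φ q) (proj₂ (faithful-any F q) (Anyₚ.map⁻ (lose p∈ p≲q)))
    where
    F : All Faithful (components φ)
    F = components-faithful φ

  represented⇒consistent×prime : ∀ {φ p} → RepresentedBy φ p → Consistent φ × Prime φ
  represented⇒consistent×prime {φ} {p} rep = (p , p⊨φ) , prime
    where
    p⊨φ : p ⊨ φ
    p⊨φ = proj₂ (rep p) (≲-refl p)
    -- every model of φ lies above p and so inherits the disjunct p satisfies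
    prime : Prime φ
    prime φ₁ φ₂ φ≤φ₁∨φ₂ with φ≤φ₁∨φ₂ p p⊨φ
    ... | sat-∨ˡ s = inj₁ λ q q⊨φ → sat-mono (proj₁ (rep q) q⊨φ) φ₁ s
    ... | sat-∨ʳ s = inj₂ λ q q⊨φ → sat-mono (proj₁ (rep q) q⊨φ) φ₂ s

  prime-disjunct : ∀ {φ} → Consistent φ → Prime φ → ∀ θs → φ ≤L ⋁ θs → Any (φ ≤L_) θs
  prime-disjunct (p , p⊨φ) _ [] φ≤⊥ with φ≤⊥ p p⊨φ
  ... | ()
  prime-disjunct consistent prime (θ ∷ θs) φ≤ with prime θ (⋁ θs) φ≤
  ... | inj₁ φ≤θ  = here φ≤θ
  ... | inj₂ φ≤θs = there (prime-disjunct consistent prime θs φ≤θs)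

  represented-equivalent : ∀ {φ θ p} → φ ≤L θ → θ ≤L φ → RepresentedBy θ p → RepresentedBy φ p
  represented-equivalent φ≤θ θ≤φ rep q = (λ s → proj₁ (rep q) (φ≤θ q s)) , (λ le → θ≤φ q (proj₂ (rep q) le))

  -- A consistent prime formula is equivalent to one of its components.
  consistent×prime⇒represented : ∀ φ → Consistent φ × Prime φ → Σ Proc λ p → RepresentedBy φ p
  consistent×prime⇒represented φ (consistent , prime) =
    proj₁ x , represented-equivalent φ≤θ θ≤φ (All.lookup (components-faithful φ) x∈cs)
    where
    φ≤⋁ : φ ≤L ⋁ (map proj₂ (components φ))
    φ≤⋁ q s = proj₂ (⋁-sat _) (Anyₚ.map⁺ (proj₁ (components-cover φ q) s))
    chosen : ∃ λ x → x ∈ components φ × φ ≤L proj₂ x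
    chosen = find (Anyₚ.map⁻ (prime-disjunct consistent prime _ φ≤⋁))
    x : Proc × Form
    x = proj₁ chosen
    x∈cs : x ∈ components φ
    x∈cs = proj₁ (proj₂ chosen)
    φ≤θ : φ ≤L proj₂ x
    φ≤θ = proj₂ (proj₂ chosen)
    θ≤φ : proj₂ x ≤L φ
    θ≤φ q s = proj₂ (components-cover φ q) (lose x∈cs s)

theorem16 : (n : ℕ) (side : Fin n → Side) → let open CC n side in
    ∀ (φ : Form) → (Σ (List Proc) λ M → RepresentedBySet φ M)
      × ((Σ Proc λ p → RepresentedBy φ p) ⇔ (Consistent φ × Prime φ))
theorem16 n side φ =
    (map proj₁ (components φ) , components-represent φ)
  , ((λ (p , rep) → represented⇒consistent×prime rep) , consistent×prime⇒represented φ)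
  where
  open CC n side
  open Theory n side
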